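{- Let $P_0^+, P_1^+, P_2^+, P_0^-, P_1^-, P_2^-$ be finite sets of propositional variables such that, for each $\circ \in \{+,-\}$, the sets $P_0^\circ$, $P_1^\circ$, $P_2^\circ$ are pairwise disjoint. Let $\mathsf{V}_0$ and $\mathsf{V}_1$ be truth assignments. If $\mathsf{V}_0 \xrightarrow[0]{(P_1^+, P_1^-)} \mathsf{V}_1$, then there exists a truth assignment $\mathsf{V}^*$ such that $\mathsf{V}_0 \xrightarrow[0]{(P_0^+ \cup P_1^+,\, P_0^- \cup P_1^-)} \mathsf{V}^*$ and $\mathsf{V}^* \xrightarrow[0]{(P_1^+ \cup P_2^+,\, P_1^- \cup P_2^-)} \mathsf{V}_1$.
   Context: Formulas are classical propositional formulas built from propositional variables, $\bot$, and $\land,\lor,\neg,\to$; truth assignments assign $0/1$ values to all formulas in the usual way. The sets $v^+(\varphi)$, $v^-(\varphi)$ of variables occurring positively/negatively in $\varphi$ are defined by: $v^+(p)=\{p\}$, $v^-(p)=\emptyset$; $v^\circ(\bot)=\emptyset$; $v^\circ(\varphi\ast\psi)=v^\circ(\varphi)\cup v^\circ(\psi)$ for $\ast\in\{\land,\lor\}$; $v^+(\neg\varphi)=v^-(\varphi)$, $v^-(\neg\varphi)=v^+(\varphi)$; $v^+(\varphi\to\psi)=v^-(\varphi)\cup v^+(\psi)$, $v^-(\varphi\to\psi)=v^+(\varphi)\cup v^-(\psi)$. For finite sets $P^+,P^-$ of variables, a $(P^+,P^-)$-formula is a formula $\varphi$ with $v^+(\varphi)\subseteq P^+$ and $v^-(\varphi)\subseteq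 P^-$. For truth assignments $\mathsf{V},\mathsf{V}'$, write $\mathsf{V} \xrightarrow[0]{(P^+,P^-)} \mathsf{V}'$ iff for every $(P^+,P^-)$-formula $\varphi$, $\mathsf{V}(\varphi)=1$ implies $\mathsf{V}'(\varphi)=1$. -}

module Defs where

open import Data.Nat using (ℕ)
open import Data.Bool using (Bool; true; false; _∧_; _∨_; not)
open import Data.List using (List; []; _∷_; _++_)
open import Data.List.Membership.Propositional using (_∈_)
open import Data.Empty using (⊥)
open import Data.Product using (_×_)
open import Relation.Binary.PropositionalEquality using (_≡_)

Var : Set
Var = ℕ

data Formula : Set where
  var  : Var → Formula
  fls  : Formula
  _∧ᶠ_ : Formula → Formula → Formula
  _∨ᶠ_ : Formula → Formula → Formula
  ¬ᶠ_  : Formula → Formula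
  _⇒ᶠ_ : Formula → Formula → Formula

Assignment : Set
Assignment = Var → Bool

eval : Assignment → Formula → Bool
eval V (var p)   = V p
eval V fls       = false
eval V (φ ∧ᶠ ψ)  = eval V φ ∧ eval V ψ
eval V (φ ∨ᶠ ψ)  = eval V φ ∨ eval V ψ
eval V (¬ᶠ φ)    = not (eval V φ)
eval V (φ ⇒ᶠ ψ)  = not (eval V φ) ∨ eval V ψ

mutual
  vpos : Formula → List Var
  vpos (var p)  = p ∷ []
  vpos fls      = []
  vpos (φ ∧ᶠ ψ) = vpos φ ++ vpos ψ
  vpos (φ ∨ᶠ ψ) = vpos φ ++ vpos ψ
  vpos (¬ᶠ φ)   = vneg φ
  vpos (φ ⇒ᶠ ψ) = vneg φ ++ vpos ψ

  vneg : Formula → List Var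
  vneg (var p)  = []
  vneg fls      = []
  vneg (φ ∧ᶠ ψ) = vneg φ ++ vneg ψ
  vneg (φ ∨ᶠ ψ) = vneg φ ++ vneg ψ
  vneg (¬ᶠ φ)   = vpos φ
  vneg (φ ⇒ᶠ ψ) = vpos φ ++ vneg ψ

-- Finite sets of variables are represented as lists; inclusion and disjointness.
_⊆ᵛ_ : List Var → List Var → Set
A ⊆ᵛ B = ∀ p → p ∈ A → p ∈ B

Disjoint : List Var → List Var → Set
Disjoint A B = ∀ p → p ∈ A → p ∈ B → ⊥

IsPNFormula : List Var → List Var → Formula → Set
IsPNFormula P⁺ P⁻ φ = (vpos φ ⊆ᵛ P⁺) × (vneg φ ⊆ᵛ P⁻)

Arrow0 : List Var → List Var → Assignment → Assignment → Set
Arrow0 P⁺ P⁻ V V' =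
  ∀ φ → IsPNFormula P⁺ P⁻ φ → eval V φ ≡ true → eval V' φ ≡ true

-- V ─[0,(P⁺,P⁻)]→ V′ holds iff V ≤ V′ pointwise on P⁺ and V′ ≤ V on P⁻:
-- evaluation is monotone in positive and antitone in negative variables, and the
-- formulas p and ¬p test the two conditions. Take V* = V₀ on P₀⁺ ∪ P₁⁺ joined with
-- V₁ on P₁⁻ ∪ P₂⁻ (false elsewhere). Its lower bounds hold by construction; an
-- upper bound can fail only at a variable of (P₀⁻ ∪ P₁⁻) ∩ (P₁⁻ ∪ P₂⁻) ⊆ P₁⁻
-- (resp. (P₀⁺ ∪ P₁⁺) ∩ (P₁⁺ ∪ P₂⁺) ⊆ P₁⁺), where V₀ ─[0,(P₁⁺,P₁⁻)]→ V₁ supplies it.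
module Submission where

open import Defs
open import Data.Bool using (Bool; true; false; _∧_; _∨_; not; _≤_; f≤t; b≤b)
open import Data.Bool.Properties using (≤-refl; ≤-trans; ≤-minimum; ≤-maximum; not-involutive)
open import Data.Nat using (_≟_)
open import Data.List using (List; []; _∷_; _++_)
open import Data.List.Membership.Propositional using (_∈_)
open import Data.List.Membership.Propositional.Properties using (∈-++⁺ˡ; ∈-++⁺ʳ; ∈-++⁻)
open import Data.List.Membership.DecPropositional _≟_ using (_∈?_)
open import Data.List.Relation.Unary.Any using (here)
open import Data.Product using (Σ; _×_; _,_; proj₁; proj₂)
open import Data.Sum using (inj₁; inj₂)
open import Data.Empty using (⊥-elim)
open import Function.Bundles using (_⇔_; mk⇔; Equivalence)
open import Function.Base using (_∘_)
open import Relation.Nullary using (yes; no; does)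
open import Relation.Binary.PropositionalEquality using (_≡_; refl; subst₂)

private
  variable
    a a′ b b′ c : Bool
    p : Var
    P Q R : List Var
    U V V′ W : Assignment

∧-mono-≤ : a ≤ a′ → b ≤ b′ → a ∧ b ≤ a′ ∧ b′
∧-mono-≤             f≤t _ = ≤-minimum _
∧-mono-≤ {a = false} b≤b _ = b≤b
∧-mono-≤ {a = true}  b≤b b≤b′ = b≤b′

∨-mono-≤ : a ≤ a′ → b ≤ b′ → a ∨ b ≤ a′ ∨ b′
∨-mono-≤             f≤t _ = ≤-maximum _
∨-mono-≤ {a = false} b≤b b≤b′ = b≤b′
∨-mono-≤ {a = true}  b≤b _ = b≤b

not-antimono-≤ : a ≤ b → not b ≤ not a
not-antimono-≤ f≤t = f≤t
not-antimono-≤ b≤b = b≤b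

∨-upperˡ : a ≤ a ∨ b
∨-upperˡ {false} = ≤-minimum _
∨-upperˡ {true}  = b≤b

∨-upperʳ : b ≤ a ∨ b
∨-upperʳ {a = false} = b≤b
∨-upperʳ {a = true}  = ≤-maximum _

∨-least : a ≤ c → b ≤ c → a ∨ b ≤ c
∨-least {false} _ b≤c = b≤c
∨-least {true}  a≤c _ = a≤c

≤⇔true⇒true : a ≤ b ⇔ (a ≡ true → b ≡ true)
≤⇔true⇒true = mk⇔ to from
  where
  to : a ≤ b → a ≡ true → b ≡ true
  to b≤b a≡true = a≡true
  from : (a ≡ true → b ≡ true) → a ≤ b
  from {false} _ = ≤-minimum _
  from {true}  a⇒b rewrite a⇒b refl = b≤b

infix 4 _≤[_]_

_≤[_]_ : Assignment → List Var → Assignment → Set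
V ≤[ P ] V′ = ∀ {p} → p ∈ P → V p ≤ V′ p

≤[]-trans : V ≤[ P ] V′ → V′ ≤[ P ] W → V ≤[ P ] W
≤[]-trans V≤V′ V′≤W p∈P = ≤-trans (V≤V′ p∈P) (V′≤W p∈P)

≤[]-++ˡ : V ≤[ P ++ Q ] V′ → V ≤[ P ] V′
≤[]-++ˡ V≤V′ p∈P = V≤V′ (∈-++⁺ˡ p∈P)

≤[]-++ʳ : ∀ P → V ≤[ P ++ Q ] V′ → V ≤[ Q ] V′
≤[]-++ʳ P V≤V′ p∈Q = V≤V′ (∈-++⁺ʳ P p∈Q)

eval-mono : ∀ φ → V ≤[ vpos φ ] V′ → V′ ≤[ vneg φ ] V → eval V φ ≤ eval V′ φ
eval-mono (var p)  pos neg = pos (here refl)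
eval-mono fls      pos neg = b≤b
eval-mono (φ ∧ᶠ ψ) pos neg =
  ∧-mono-≤ (eval-mono φ (≤[]-++ˡ pos) (≤[]-++ˡ neg))
           (eval-mono ψ (≤[]-++ʳ (vpos φ) pos) (≤[]-++ʳ (vneg φ) neg))
eval-mono (φ ∨ᶠ ψ) pos neg =
  ∨-mono-≤ (eval-mono φ (≤[]-++ˡ pos) (≤[]-++ˡ neg))
           (eval-mono ψ (≤[]-++ʳ (vpos φ) pos) (≤[]-++ʳ (vneg φ) neg))
eval-mono (¬ᶠ φ)   pos neg = not-antimono-≤ (eval-mono φ neg pos)
eval-mono (φ ⇒ᶠ ψ) pos neg =
  ∨-mono-≤ (not-antimono-≤ (eval-mono φ (≤[]-++ˡ neg) (≤[]-++ˡ pos)))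
           (eval-mono ψ (≤[]-++ʳ (vneg φ) pos) (≤[]-++ʳ (vpos φ) neg))

≤[]⇒Arrow0 : V ≤[ P ] V′ → V′ ≤[ Q ] V → Arrow0 P Q V V′
≤[]⇒Arrow0 pos neg φ (vpos⊆P , vneg⊆Q) =
  Equivalence.to ≤⇔true⇒true
    (eval-mono φ (λ {p} → pos ∘ vpos⊆P p) (λ {p} → neg ∘ vneg⊆Q p))

Arrow0⇒≤[] : Arrow0 P Q V V′ → V ≤[ P ] V′ × V′ ≤[ Q ] V
Arrow0⇒≤[] {P} {Q} {V} {V′} V→V′ = pos , neg
  where
  singleton-⊆ : p ∈ R → (p ∷ []) ⊆ᵛ R
  singleton-⊆ p∈R _ (here refl) = p∈R
  pos : V ≤[ P ] V′
  pos {p} p∈P = Equivalence.from ≤⇔true⇒true (V→V′ (var p) (singleton-⊆ p∈P , λ _ ()))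
  neg : V′ ≤[ Q ] V
  neg {p} p∈Q =
    subst₂ _≤_ (not-involutive (V′ p)) (not-involutive (V p)) (not-antimono-≤
      (Equivalence.from ≤⇔true⇒true (V→V′ (¬ᶠ var p) ((λ _ ()) , singleton-⊆ p∈Q))))

restrict : List Var → Assignment → Assignment
restrict P V p = does (p ∈? P) ∧ V p

_⊔_ : Assignment → Assignment → Assignment
(V ⊔ W) p = V p ∨ W p

restrict-≥ : ∀ P V → V ≤[ P ] restrict P V
restrict-≥ P V {p} p∈P with p ∈? P
... | yes _   = ≤-refl
... | no p∉P = ⊥-elim (p∉P p∈P)

restrict-≤ : ∀ P V → (∀ {p} → p ∈ P → p ∈ Q → V p ≤ W p) → restrict P V ≤[ Q ] W
restrict-≤ {W = W} P V V≤W {p} p∈Q with p ∈? P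
... | yes p∈P = V≤W p∈P p∈Q
... | no _    = ≤-minimum (W p)

⊔-upperˡ : ∀ V W → V ≤[ P ] V ⊔ W
⊔-upperˡ _ _ _ = ∨-upperˡ

⊔-upperʳ : ∀ V W → W ≤[ P ] V ⊔ W
⊔-upperʳ _ _ _ = ∨-upperʳ

⊔-least : ∀ V W → V ≤[ P ] U → W ≤[ P ] U → V ⊔ W ≤[ P ] U
⊔-least _ _ V≤U W≤U p∈P = ∨-least (V≤U p∈P) (W≤U p∈P)

∈-++-overlap : Disjoint P R → p ∈ P ++ Q → p ∈ Q ++ R → p ∈ Q
∈-++-overlap {P} {R} {p} {Q} P#R p∈P++Q p∈Q++R with ∈-++⁻ P p∈P++Q | ∈-++⁻ Q p∈Q++R
... | inj₂ p∈Q | _        = p∈Q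
... | inj₁ _   | inj₁ p∈Q = p∈Q
... | inj₁ p∈P | inj₂ p∈R = ⊥-elim (P#R p p∈P p∈R)

theorem2p3 : (P0⁺ P1⁺ P2⁺ P0⁻ P1⁻ P2⁻ : List Var) →
    Disjoint P0⁺ P1⁺ → Disjoint P0⁺ P2⁺ → Disjoint P1⁺ P2⁺ →
    Disjoint P0⁻ P1⁻ → Disjoint P0⁻ P2⁻ → Disjoint P1⁻ P2⁻ →
    (V0 V1 : Assignment) →
    Arrow0 P1⁺ P1⁻ V0 V1 →
    Σ Assignment (λ Vs →
      Arrow0 (P0⁺ ++ P1⁺) (P0⁻ ++ P1⁻) V0 Vs ×
      Arrow0 (P1⁺ ++ P2⁺) (P1⁻ ++ P2⁻) Vs V1)
theorem2p3 P0⁺ P1⁺ P2⁺ P0⁻ P1⁻ P2⁻ _ P0⁺#P2⁺ _ _ P0⁻#P2⁻ _ V0 V1 V0→V1 =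
  V* , ≤[]⇒Arrow0 V0≤V* V*≤V0 , ≤[]⇒Arrow0 V*≤V1 V1≤V*
  where
  A B : List Var
  A = P0⁺ ++ P1⁺
  B = P1⁻ ++ P2⁻
  V0|A V1|B V* : Assignment
  V0|A = restrict A V0
  V1|B = restrict B V1
  V* = V0|A ⊔ V1|B
  V0≤V1 : V0 ≤[ P1⁺ ] V1
  V0≤V1 = proj₁ (Arrow0⇒≤[] V0→V1)
  V1≤V0 : V1 ≤[ P1⁻ ] V0
  V1≤V0 = proj₂ (Arrow0⇒≤[] V0→V1)
  V0≤V* : V0 ≤[ A ] V*
  V0≤V* = ≤[]-trans (restrict-≥ A V0) (⊔-upperˡ V0|A V1|B)
  V1≤V* : V1 ≤[ B ] V*
  V1≤V* = ≤[]-trans (restrict-≥ B V1) (⊔-upperʳ V0|A V1|B)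
  V*≤V0 : V* ≤[ P0⁻ ++ P1⁻ ] V0
  V*≤V0 = ⊔-least V0|A V1|B (restrict-≤ A V0 λ _ _ → ≤-refl)
            (restrict-≤ B V1 λ p∈B p∈C → V1≤V0 (∈-++-overlap P0⁻#P2⁻ p∈C p∈B))
  V*≤V1 : V* ≤[ P1⁺ ++ P2⁺ ] V1
  V*≤V1 = ⊔-least V0|A V1|B
            (restrict-≤ A V0 λ p∈A p∈C → V0≤V1 (∈-++-overlap P0⁺#P2⁺ p∈A p∈C))
            (restrict-≤ B V1 λ _ _ → ≤-refl)
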